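{- For an integer $n\ge 2$ let $$A_n=\Big\{(x_1,\dots,x_n)\in\mathbb{Z}^n:\ n\ge x_1\ge x_2\ge\cdots\ge x_n\ge 0,\ \sum_{i=1}^k x_i\le 2n+6k-16 \text{ for all } k\in\{1,\dots,n\},\ \text{and } \sum_{i=1}^n x_i\le 6n-12\Big\},$$ and let $S_n(x_1,\dots,x_n)=\sum_{1\le i<j\le n}x_ix_j^2$. There is an absolute constant $C$ such that for every $n\ge 2$ and every $(x_1,\dots,x_n)\in A_n$ with $x_2\le \frac{n}{18}$, we have $S_n(x_1,\dots,x_n)\le n^3+Cn^2$. -}

module Defs where

open import Data.Nat using (ℕ; zero; suc; _+_; _*_; _≤_; _^_)
open import Data.Fin using (Fin; zero; suc; toℕ; inject₁; _<_)

psum : ∀ {n} (k : ℕ) → (Fin n → ℕ) → ℕ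
psum zero    x = 0
psum {zero}  (suc k) x = 0
psum {suc n} (suc k) x = x zero + psum k (λ i → x (suc i))

total : ∀ {n} → (Fin n → ℕ) → ℕ
total {n} x = psum n x

-- S_n(x) = Σ_{i<j} x_i x_j^2, computed recursively:
-- S(x_1,...,x_n) = x_1 * (x_2^2 + ... + x_n^2) + S(x_2,...,x_n)
sqsum : ∀ {n} → (Fin n → ℕ) → ℕ
sqsum {zero}  x = 0
sqsum {suc n} x = x zero * x zero + sqsum (λ i → x (suc i))

S : ∀ {n} → (Fin n → ℕ) → ℕ
S {zero}  x = 0
S {suc n} x = x zero * sqsum (λ i → x (suc i)) + S (λ i → x (suc i))

-- InA n x : membership of x in A_{n+1} (x has n+1 entries).
-- membership in A_n (entries are integers, forced nonnegative, so ℕ-valued).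
-- x_1 ≥ ... ≥ x_n ; x_1 ≤ n ; prefix bound Σ_{i≤k} x_i ≤ 2n+6k-16 written as
-- Σ_{i≤k} x_i + 16 ≤ 2n + 6k (equivalent over ℤ); total + 12 ≤ 6n.
record InA (n : ℕ) (x : Fin (suc n) → ℕ) : Set where
  field
    top      : x zero ≤ suc n
    nonincr  : ∀ (i j : Fin (suc n)) → i < j → x j ≤ x i
    prefix   : ∀ (k : ℕ) → 1 ≤ k → k ≤ suc n → psum k x + 16 ≤ 2 * suc n + 6 * k
    totalB   : total x + 12 ≤ 6 * suc n

-- Every entry after the first is at most a = x₂, so each x_i x_j² with i < j is at most
-- a x_i x_j, and summing gives 2 S(x) ≤ a (Σ x)². Together with 18 x₂ ≤ n and Σ x ≤ 6n
-- this yields 36 S(x) ≤ n (6n)² = 36 n³, so the constant C = 0 works.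
module Submission where

open import Defs
open import Data.Nat using (ℕ; zero; suc; _+_; _*_; _≤_; _^_; z≤n; s≤s)
open import Data.Nat.Properties
open import Data.Fin using (Fin; zero; suc)
open import Data.Product using (∃; _,_)
open import Relation.Binary.PropositionalEquality using (_≡_; refl; sym; cong)
open import Data.Nat.Solver using (module +-*-Solver)
open +-*-Solver

sqsum≤*total : ∀ {k} (a : ℕ) (y : Fin k → ℕ) → (∀ i → y i ≤ a) → sqsum y ≤ a * total y
sqsum≤*total {zero}  a y y≤a = z≤n
sqsum≤*total {suc k} a y y≤a = begin
    y zero * y zero + sqsum (λ i → y (suc i))
      ≤⟨ +-mono-≤ (*-monoˡ-≤ (y zero) (y≤a zero))
                  (sqsum≤*total a (λ i → y (suc i)) (λ i → y≤a (suc i))) ⟩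
    a * y zero + a * total (λ i → y (suc i))
      ≡⟨ sym (*-distribˡ-+ a (y zero) _) ⟩
    a * total y ∎
  where open ≤-Reasoning

*-square-+ : ∀ a y t → a * ((y + t) * (y + t)) ≡ a * (y * y) + (2 * y * (a * t) + a * (t * t))
*-square-+ = solve 3 (λ a y t → a :* ((y :+ t) :* (y :+ t))
                              := a :* (y :* y) :+ (con 2 :* y :* (a :* t) :+ a :* (t :* t))) refl

2*S≤*total² : ∀ {k} (a : ℕ) (x : Fin (suc k) → ℕ) → (∀ i → x (suc i) ≤ a) →
              2 * S x ≤ a * (total x * total x)

2*S≤*total²-bounded : ∀ {k} (a : ℕ) (y : Fin k → ℕ) → (∀ i → y i ≤ a) →
                      2 * S y ≤ a * (total y * total y)
2*S≤*total²-bounded {zero}  a y y≤a = z≤n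
2*S≤*total²-bounded {suc k} a y y≤a = 2*S≤*total² a y (λ i → y≤a (suc i))

2*S≤*total² {k} a x tail≤a = begin
    2 * (x₁ * sqsum r + S r)
      ≡⟨ *-distribˡ-+ 2 (x₁ * sqsum r) (S r) ⟩
    2 * (x₁ * sqsum r) + 2 * S r
      ≡⟨ cong (_+ 2 * S r) (sym (*-assoc 2 x₁ (sqsum r))) ⟩
    2 * x₁ * sqsum r + 2 * S r
      ≤⟨ +-mono-≤ (*-monoʳ-≤ (2 * x₁) (sqsum≤*total a r tail≤a)) (2*S≤*total²-bounded a r tail≤a) ⟩
    2 * x₁ * (a * total r) + a * (total r * total r)
      ≤⟨ m≤n+m _ (a * (x₁ * x₁)) ⟩
    a * (x₁ * x₁) + (2 * x₁ * (a * total r) + a * (total r * total r))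
      ≡⟨ sym (*-square-+ a x₁ (total r)) ⟩
    a * (total x * total x) ∎
  where
  open ≤-Reasoning
  x₁ = x zero
  r : Fin k → ℕ
  r i = x (suc i)

InA-tail≤second : ∀ {m} {x : Fin (suc (suc m)) → ℕ} → InA (suc m) x →
                  ∀ i → x (suc i) ≤ x (suc zero)
InA-tail≤second A zero    = ≤-refl
InA-tail≤second A (suc j) = InA.nonincr A (suc zero) (suc (suc j)) (s≤s (s≤s z≤n))

InA-total≤6n : ∀ {m} {x : Fin (suc (suc m)) → ℕ} → InA (suc m) x → total x ≤ 6 * suc (suc m)
InA-total≤6n {x = x} A = ≤-trans (m≤m+n (total x) 12) (InA.totalB A)

36*cube : ∀ n → 36 * (n ^ 3 + 0 * n ^ 2) ≡ n * (6 * n * (6 * n))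
36*cube = solve 1 (λ n → con 36 :* (n :^ 3 :+ con 0 :* n :^ 2) := n :* (con 6 :* n :* (con 6 :* n))) refl

lemma4 : ∃ λ (C : ℕ) → ∀ (m : ℕ) → let n = suc (suc m) in
    (x : Fin n → ℕ) → InA (suc m) x → 18 * x (suc zero) ≤ n →
    S x ≤ n ^ 3 + C * n ^ 2
lemma4 = 0 , λ m x A 18a≤n → *-cancelˡ-≤ 36 (begin
    36 * S x
      ≡⟨ *-assoc 18 2 (S x) ⟩
    18 * (2 * S x)
      ≤⟨ *-monoʳ-≤ 18 (2*S≤*total² (x (suc zero)) x (InA-tail≤second A)) ⟩
    18 * (x (suc zero) * (total x * total x))
      ≡⟨ sym (*-assoc 18 (x (suc zero)) _) ⟩
    18 * x (suc zero) * (total x * total x)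
      ≤⟨ *-mono-≤ 18a≤n (*-mono-≤ (InA-total≤6n A) (InA-total≤6n A)) ⟩
    suc (suc m) * (6 * suc (suc m) * (6 * suc (suc m)))
      ≡⟨ sym (36*cube (suc (suc m))) ⟩
    36 * (suc (suc m) ^ 3 + 0 * suc (suc m) ^ 2) ∎)
  where
  open ≤-Reasoning
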